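{- Let $p$ be a prime, $H$ a square-free graph, and $C=\theta\gamma_1\gamma_2\cdots\gamma_k\theta$ a cycle in $H$ of length at least 3 such that $\deg(\gamma_i)\equiv1\pmod p$ for all $i\in\{1,\dots,k\}$ and $\deg(\theta)\not\equiv1\pmod p$. Let $\mathcal K=(K,\tau)$ be the partial $H$-labelled graph with $V(K)=\{s,t\}\cup\{v_i,u_i:1\le i\le k\}$, $E(K)=\{v_iv_{i+1}:1\le i\le k-1\}\cup\{v_iu_i:1\le i\le k\}\cup\{sv_1,v_kt\}$ and pinning $\tau(u_i)=\gamma_i$. Let $\Delta_1=\Delta_2=N_H(\theta)$, $\delta_1=\gamma_1$, $\delta_2=\gamma_k$. Then for any $\omega_s\in\Delta_1\setminus\{\delta_1\}$ and $\omega_t\in\Delta_2\setminus\{\delta_2\}$: (1) $|\mathsf{Hom}((\mathcal K,s,t),(H,\omega_s,\omega_t))|=0$; (2) $|\mathsf{Hom}((\mathcal K,s,t),(H,\delta_1,\omega_t))|\equiv1\pmod p$; (3) $|\mathsf{Hom}((\mathcal K,s,t),(H,\omega_s,\delta_2))|\equiv1\pmod p$; (4) $|\mathsf{Hom}((\mathcal K,s,t),(H,\delta_1,\delta_2))|\equiv1\pmod p$.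
   Context: Graphs are finite, undirected, loopless, without parallel edges; square-free means no cycle of length 4; $N_H(v)$ and $\deg(v)$ are the neighbourhood and degree of $v$. A partial $H$-labelled graph is a graph with a partial pinning function to $V(H)$; $\mathsf{Hom}((\mathcal G,x_1,x_2),(H,y_1,y_2))$ is the set of graph homomorphisms $\mathcal G\to H$ extending the pinning and mapping $x_i$ to $y_i$. -}

module Defs where

open import Data.Nat using (ℕ; zero; suc; _+_; _≡ᵇ_)
open import Data.Fin using (Fin; zero; suc; toℕ; splitAt; _≟_)
open import Data.Fin.Properties using (all?)
open import Data.Bool using (Bool; true; false; _∨_)
import Data.Bool as B
open import Data.Maybe using (Maybe; just; nothing)
open import Data.Sum using (_⊎_; inj₁; inj₂)
open import Data.Unit using (⊤; tt)
open import Data.List using (List; []; _∷_; [_]; map; concatMap; filter; length)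
open import Data.List using () renaming (allFin to allFinL)
open import Data.Vec using (Vec; []; _∷_; lookup)
open import Data.Integer using (ℤ; +_; _-_)
open import Data.Integer.Divisibility using () renaming (_∣_ to _∣ℤ_)
open import Relation.Binary.PropositionalEquality using (_≡_; _≢_)
open import Relation.Nullary using (Dec; yes; no; ¬_)
open import Relation.Nullary.Decidable using (_×-dec_; _→-dec_)
open import Data.Product using (_×_; Σ; ∃; _,_)

record Graph : Set where
  field
    n      : ℕ
    adj    : Fin n → Fin n → Bool
    symm   : ∀ x y → adj x y ≡ adj y x
    irrefl : ∀ x → adj x x ≡ false
open Graph public

Adj : (H : Graph) → Fin (n H) → Fin (n H) → Set
Adj H x y = adj H x y ≡ true

SquareFree : Graph → Set
SquareFree H = ∀ (a b c d : Fin (n H)) →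
  a ≢ b → a ≢ c → a ≢ d → b ≢ c → b ≢ d → c ≢ d →
  ¬ (Adj H a b × Adj H b c × Adj H c d × Adj H d a)

deg : (H : Graph) → Fin (n H) → ℕ
deg H v = length (filter (λ w → adj H v w B.≟ true) (allFinL (n H)))

_≡_[mod_] : ℕ → ℕ → ℕ → Set
a ≡ b [mod p ] = (+ p) ∣ℤ ((+ a) - (+ b))

record PartialLabelled (H : Graph) : Set where
  field
    m   : ℕ
    adjG : Fin m → Fin m → Bool
    pin : Fin m → Maybe (Fin (n H))
open PartialLabelled public

PinOK : ∀ {k} → Maybe (Fin k) → Fin k → Set
PinOK nothing  _ = ⊤
PinOK (just h) y = y ≡ h

pinOK? : ∀ {k} (o : Maybe (Fin k)) (y : Fin k) → Dec (PinOK o y)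
pinOK? nothing  _ = yes tt
pinOK? (just h) y = y ≟ h

IsHom : (H : Graph) (G : PartialLabelled H) (x₁ x₂ : Fin (m G)) (y₁ y₂ : Fin (n H))
        → Vec (Fin (n H)) (m G) → Set
IsHom H G x₁ x₂ y₁ y₂ f =
  (∀ x y → adjG G x y ≡ true → adj H (lookup f x) (lookup f y) ≡ true)
  × (∀ x → PinOK (pin G x) (lookup f x))
  × (lookup f x₁ ≡ y₁)
  × (lookup f x₂ ≡ y₂)

isHom? : ∀ H G x₁ x₂ y₁ y₂ f → Dec (IsHom H G x₁ x₂ y₁ y₂ f)
isHom? H G x₁ x₂ y₁ y₂ f =
  all? (λ x → all? (λ y → (adjG G x y B.≟ true) →-dec (adj H (lookup f x) (lookup f y) B.≟ true)))
  ×-dec all? (λ x → pinOK? (pin G x) (lookup f x))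
  ×-dec (lookup f x₁ ≟ y₁)
  ×-dec (lookup f x₂ ≟ y₂)

allVecs : (m k : ℕ) → List (Vec (Fin k) m)
allVecs zero    k = [ [] ]
allVecs (suc m) k = concatMap (λ i → map (i ∷_) (allVecs m k)) (allFinL k)

homCount : (H : Graph) (G : PartialLabelled H) (x₁ x₂ : Fin (m G)) (y₁ y₂ : Fin (n H)) → ℕ
homCount H G x₁ x₂ y₁ y₂ = length (filter (isHom? H G x₁ x₂ y₁ y₂) (allVecs (m G) (n H)))

-- The gadget K for a cycle θ γ₁ … γ_k θ.  Indices of γ, v, u are Fin k
-- (index i : Fin k stands for i+1).
-- V(K) = Fin (2 + (k + k)):  0 = s, 1 = t, 2+i = v_{i+1}, 2+k+i = u_{i+1}.

data KV (k : ℕ) : Set where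
  vs vt : KV k
  vv vu : Fin k → KV k

decodeK : ∀ k → Fin (2 + (k + k)) → KV k
decodeK k x with splitAt 2 x
... | inj₁ zero = vs
... | inj₁ (suc _) = vt
... | inj₂ y with splitAt k y
...   | inj₁ i = vv i
...   | inj₂ i = vu i

edgeK : ∀ k → KV k → KV k → Bool
edgeK k vs     (vv i) = toℕ i ≡ᵇ 0
edgeK k (vv i) (vv j) = toℕ j ≡ᵇ suc (toℕ i)
edgeK k (vv i) (vu j) = toℕ i ≡ᵇ toℕ j
edgeK k (vv i) vt     = suc (toℕ i) ≡ᵇ k
edgeK k _      _      = false

adjK : ∀ k → Fin (2 + (k + k)) → Fin (2 + (k + k)) → Bool
adjK k x y = edgeK k (decodeK k x) (decodeK k y) ∨ edgeK k (decodeK k y) (decodeK k x)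

pinK : (H : Graph) (k : ℕ) → (Fin k → Fin (n H)) → Fin (2 + (k + k)) → Maybe (Fin (n H))
pinK H k γ x with decodeK k x
... | vu i = just (γ i)
... | _    = nothing

𝒦 : (H : Graph) (k : ℕ) → (Fin k → Fin (n H)) → PartialLabelled H
𝒦 H k γ = record { m = 2 + (k + k) ; adjG = adjK k ; pin = pinK H k γ }

sK tK : ∀ k → Fin (2 + (k + k))
sK k = zero
tK k = suc zero

IsCycle : (H : Graph) (k : ℕ) (θ : Fin (n H)) (γ : Fin k → Fin (n H)) → Set
IsCycle H k θ γ =
  (∀ i j → γ i ≡ γ j → i ≡ j)
  × (∀ i → γ i ≢ θ)
  × (∀ (i j : Fin k) → toℕ j ≡ suc (toℕ i) → Adj H (γ i) (γ j))
  × (∀ (i : Fin k) → toℕ i ≡ 0 → Adj H θ (γ i))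
  × (∀ (i : Fin k) → suc (toℕ i) ≡ k → Adj H (γ i) θ)

module Submission where

-- A homomorphism of 𝒦 pinned at s ↦ y₁, t ↦ y₂ is a walk y₁ w₁ … w_k y₂ in H with
-- wᵢ ∼ γᵢ, so all four counts are walk counts.  In a square-free graph two distinct
-- vertices have at most one common neighbour.  Hence a walk entering the path from the
-- side (from ω_s ≠ γ₁ through θ) is forced to follow it one step behind and ends at
-- γ_{k-1}, which gives (1) and (3).  A walk starting at γ₁ may first step to any
-- neighbour of γ₁; a step to a neighbour other than γ₂ is forced back to γ₁ and then
-- along the path, so these deg γ₁ − 1 ≡ 0 detours contribute equally and vanish mod p.
-- Telescoping leaves only the walks γ_k w y with w ∼ γ_k, y: deg γ_k ≡ 1 of them
-- when y = γ_k and exactly one (through θ) when y = ω_t.  This gives (2) and (4).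

open import Defs
open import Data.Bool using (true; false; if_then_else_; T)
import Data.Bool as Bool
open import Data.Bool.Properties using (T-≡; T-∨)
open import Data.Empty using (⊥-elim)
open import Data.Fin using (Fin; zero; suc; fromℕ; toℕ; splitAt; _↑ˡ_; _↑ʳ_; _≟_)
open import Data.Fin.Properties
  using (0≢1+n; toℕ-fromℕ; toℕ-injective; punchInᵢ≢i; splitAt-↑ˡ; splitAt-↑ʳ)
  renaming (suc-injective to Fin-suc-injective)
open import Data.List as List using (List; []; _∷_; filter; length; concatMap)
open import Data.List.Properties using (filter-++; length-++)
open import Data.Maybe using (just)
open import Data.Nat using (ℕ; zero; suc; _+_; _*_; _≤_)
open import Data.Nat.Divisibility using (divides; ∣1⇒≡1)
open import Data.Nat.Primality using (Prime; ¬prime[1])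
open import Data.Nat.Properties
  using (+-*-semiring; suc-injective; ≡ᵇ⇒≡; ≡⇒≡ᵇ; +-comm; +-assoc; +-identityʳ; *-identityˡ; *-zeroʳ;
         +-cancelʳ-≡)
open import Data.Nat.Tactic.RingSolver using (solve-∀)
open import Data.Product using (_×_; _,_; proj₁; proj₂; ∃-syntax)
open import Data.Sum using (inj₁; inj₂)
open import Data.Vec using (Vec; []; _∷_; _++_; lookup; tabulate; last; init)
import Data.Vec.Functional as Vector
open import Data.Vec.Properties
  using (∷-injective; lookup-splitAt; lookup∘tabulate; tabulate∘lookup; tabulate-cong)
open import Data.Vec.Relation.Unary.All using (All; _∷_)
open import Data.Vec.Relation.Unary.All.Properties using (tabulate⁺)
open import Function using (_∘_; _⇔_; mk⇔; Equivalence)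
open import Relation.Binary.PropositionalEquality
open import Relation.Nullary using (Dec; yes; no; ¬_; does; _because_)
open import Relation.Nullary.Decidable using (_×-dec_; dec-true; dec-false; does-⇔)
open import Relation.Unary using (Pred; Decidable)

open import Algebra.Properties.Semiring.Sum +-*-semiring
  using (sum; sum-syntax; sum-remove; sum-replicate-zero; sum-cong-≗; *-distribˡ-sum; *-distribʳ-sum)

⟦_⟧ : ∀ {a} {A : Set a} → Dec A → ℕ
⟦ a? ⟧ = if does a? then 1 else 0

⟦⟧-×-dec : ∀ {a b} {A : Set a} {B : Set b} (a? : Dec A) (b? : Dec B) →
           ⟦ a? ×-dec b? ⟧ ≡ ⟦ a? ⟧ * ⟦ b? ⟧
⟦⟧-×-dec (true  because _) b? = sym (+-identityʳ ⟦ b? ⟧)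
⟦⟧-×-dec (false because _) b? = refl

⟦⟧-≡1 : ∀ {a} {A : Set a} (a? : Dec A) → A → ⟦ a? ⟧ ≡ 1
⟦⟧-≡1 a? a = cong (if_then 1 else 0) (dec-true a? a)

⟦⟧-≡0 : ∀ {a} {A : Set a} (a? : Dec A) → ¬ A → ⟦ a? ⟧ ≡ 0
⟦⟧-≡0 a? ¬a = cong (if_then 1 else 0) (dec-false a? ¬a)

⟦⟧-⇔ : ∀ {a b} {A : Set a} {B : Set b} → A ⇔ B → (a? : Dec A) (b? : Dec B) → ⟦ a? ⟧ ≡ ⟦ b? ⟧
⟦⟧-⇔ A⇔B a? b? = cong (if_then 1 else 0) (does-⇔ A⇔B a? b?)

sum-single : ∀ {n} {f : Fin n → ℕ} (z : Fin n) → (∀ i → i ≢ z → f i ≡ 0) → sum f ≡ f z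
sum-single {suc n} {f} z off = begin
  sum f                             ≡⟨ sum-remove f ⟩
  f z + sum (Vector.removeAt f z)   ≡⟨ cong (f z +_) (sum-cong-≗ λ j → off _ (punchInᵢ≢i z j)) ⟩
  f z + sum (Vector.replicate n 0)  ≡⟨ cong (f z +_) (sum-replicate-zero n) ⟩
  f z + 0                           ≡⟨ +-identityʳ (f z) ⟩
  f z                               ∎
  where open ≡-Reasoning

sum-exchange : ∀ {n} {f g : Fin n → ℕ} (z : Fin n) → (∀ i → i ≢ z → f i ≡ g i) →
               sum f + g z ≡ f z + sum g
sum-exchange {suc n} {f} {g} z agree = begin
  sum f + g z                              ≡⟨ cong (_+ g z) (sum-remove f) ⟩
  f z + sum (Vector.removeAt f z) + g z    ≡⟨ cong (λ s → f z + s + g z) (sum-cong-≗ λ j →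
                                                agree _ (punchInᵢ≢i z j)) ⟩
  f z + sum (Vector.removeAt g z) + g z    ≡⟨ +-assoc (f z) _ (g z) ⟩
  f z + (sum (Vector.removeAt g z) + g z)  ≡⟨ cong (f z +_) (+-comm _ (g z)) ⟩
  f z + (g z + sum (Vector.removeAt g z))  ≡⟨ cong (f z +_) (sum-remove g) ⟨
  f z + sum g                              ∎
  where open ≡-Reasoning

module _ {a p} {A : Set a} {P : Pred A p} (P? : Decidable P) where

  length-filter-tabulate : ∀ {n} (f : Fin n → A) →
                           length (filter P? (List.tabulate f)) ≡ ∑[ i < n ] ⟦ P? (f i) ⟧
  length-filter-tabulate {zero}  f = refl
  length-filter-tabulate {suc n} f with P? (f zero)
  ... | yes _ = cong suc (length-filter-tabulate (f ∘ suc))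
  ... | no  _ = length-filter-tabulate (f ∘ suc)

  length-filter-concatMap-tabulate : ∀ {b} {B : Set b} {n} (g : B → List A) (f : Fin n → B) →
    length (filter P? (concatMap g (List.tabulate f))) ≡ ∑[ i < n ] length (filter P? (g (f i)))
  length-filter-concatMap-tabulate {n = zero}  g f = refl
  length-filter-concatMap-tabulate {n = suc n} g f =
    trans (cong length (filter-++ P? (g (f zero)) _))
          (trans (length-++ (filter P? (g (f zero))))
                 (cong (_ +_) (length-filter-concatMap-tabulate g (f ∘ suc))))

length-filter-map : ∀ {a b p} {A : Set a} {B : Set b} {P : Pred B p} (P? : Decidable P) (h : A → B) xs →
                    length (filter P? (List.map h xs)) ≡ length (filter (P? ∘ h) xs)
length-filter-map P? h []       = refl
length-filter-map P? h (x ∷ xs) with P? (h x)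
... | yes _ = cong suc (length-filter-map P? h xs)
... | no  _ = length-filter-map P? h xs

∑ⱽ : ∀ {N} m → (Vec (Fin N) m → ℕ) → ℕ
∑ⱽ     zero    F = F []
∑ⱽ {N} (suc m) F = ∑[ i < N ] ∑ⱽ m (λ v → F (i ∷ v))

length-filter-allVecs : ∀ {p} N m {P : Pred (Vec (Fin N) m) p} (P? : Decidable P) →
                        length (filter P? (allVecs m N)) ≡ ∑ⱽ m (λ v → ⟦ P? v ⟧)
length-filter-allVecs N zero P? with P? []
... | yes _ = refl
... | no  _ = refl
length-filter-allVecs N (suc m) P? =
  trans (length-filter-concatMap-tabulate P? (λ i → List.map (i ∷_) (allVecs m N)) (λ i → i))
        (sum-cong-≗ λ i → trans (length-filter-map P? (i ∷_) (allVecs m N))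
                                (length-filter-allVecs N m (P? ∘ (i ∷_))))

∑ⱽ-cong : ∀ {N} m {F G : Vec (Fin N) m → ℕ} → (∀ v → F v ≡ G v) → ∑ⱽ m F ≡ ∑ⱽ m G
∑ⱽ-cong zero    F≗G = F≗G []
∑ⱽ-cong (suc m) F≗G = sum-cong-≗ λ i → ∑ⱽ-cong m (F≗G ∘ (i ∷_))

∑ⱽ-zero : ∀ {N} m {F : Vec (Fin N) m → ℕ} → (∀ v → F v ≡ 0) → ∑ⱽ m F ≡ 0
∑ⱽ-zero     zero    F≗0 = F≗0 []
∑ⱽ-zero {N} (suc m) F≗0 = trans (sum-cong-≗ λ i → ∑ⱽ-zero m (F≗0 ∘ (i ∷_))) (sum-replicate-zero N)

∑ⱽ-single : ∀ {N m} {F : Vec (Fin N) m → ℕ} (w : Vec (Fin N) m) → (∀ v → v ≢ w → F v ≡ 0) →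
            ∑ⱽ m F ≡ F w
∑ⱽ-single []      off = refl
∑ⱽ-single (x ∷ w) off =
  trans (sum-single x λ i i≢x → ∑ⱽ-zero _ λ v → off (i ∷ v) (i≢x ∘ proj₁ ∘ ∷-injective))
        (∑ⱽ-single w λ v v≢w → off (x ∷ v) (v≢w ∘ proj₂ ∘ ∷-injective))

∑ⱽ-*ˡ : ∀ {N} m (c : ℕ) (F : Vec (Fin N) m → ℕ) → ∑ⱽ m (λ v → c * F v) ≡ c * ∑ⱽ m F
∑ⱽ-*ˡ zero    c F = refl
∑ⱽ-*ˡ (suc m) c F =
  trans (sum-cong-≗ λ i → ∑ⱽ-*ˡ m c (F ∘ (i ∷_)))
        (sym (*-distribˡ-sum c (λ i → ∑ⱽ m (F ∘ (i ∷_)))))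

∑ⱽ-++ : ∀ {N} m k (F : Vec (Fin N) (m + k) → ℕ) →
        ∑ⱽ (m + k) F ≡ ∑ⱽ m (λ v → ∑ⱽ k (λ w → F (v ++ w)))
∑ⱽ-++ zero    k F = refl
∑ⱽ-++ (suc m) k F = sum-cong-≗ λ i → ∑ⱽ-++ m k (F ∘ (i ∷_))

OneModulo : ℕ → ℕ → Set
OneModulo p d = ∃[ q ] d ≡ suc (q * p)

oneModulo⇒≡1 : ∀ {p d} → OneModulo p d → d ≡ 1 [mod p ]
oneModulo⇒≡1 (q , refl) = divides q refl

≡1⇒oneModulo : ∀ {p} d → Prime p → d ≡ 1 [mod p ] → OneModulo p d
≡1⇒oneModulo zero    p-prime p∣1 = ⊥-elim (¬prime[1] (subst Prime (∣1⇒≡1 p∣1) p-prime))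
≡1⇒oneModulo (suc d) _ (divides q d≡q*p) = q , cong suc d≡q*p

oneModulo-cancel : ∀ {p X Y d e} → OneModulo p Y → OneModulo p d → X + e ≡ Y + d * e → OneModulo p X
oneModulo-cancel {p} {X} {e = e} (q′ , refl) (q , refl) X+e≡ =
  q′ + q * e , +-cancelʳ-≡ e X _ (trans X+e≡ (regroup q′ q p e))
  where
  regroup : ∀ q′ q p e → suc (q′ * p) + suc (q * p) * e ≡ suc ((q′ + q * e) * p) + e
  regroup = solve-∀

penultimate : ∀ {a} {A : Set a} {m} → Vec A (2 + m) → A
penultimate = last ∘ init

penultimate-All : ∀ {a p} {A : Set a} {P : Pred A p} {m} {xs : Vec A (2 + m)} →
                  All P xs → P (penultimate xs)
penultimate-All {xs = _ ∷ _ ∷ []}    (px ∷ _)  = px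
penultimate-All {xs = _ ∷ _ ∷ _ ∷ _} (_ ∷ pxs) = penultimate-All pxs

last-tabulate : ∀ {a} {A : Set a} {m} (f : Fin (suc m) → A) → last (tabulate f) ≡ f (fromℕ m)
last-tabulate {m = zero}  f = refl
last-tabulate {m = suc m} f = last-tabulate (f ∘ suc)

module WalkCounts (H : Graph) where

  V : Set
  V = Fin (n H)

  adj? : ∀ x y → Dec (Adj H x y)
  adj? x y = adj H x y Bool.≟ true

  A : V → V → ℕ
  A x y = ⟦ adj? x y ⟧

  adj-sym : ∀ {x y} → Adj H x y → Adj H y x
  adj-sym {x} {y} xy = trans (symm H y x) xy

  adj⇒≢ : ∀ {x y} → Adj H x y → x ≢ y
  adj⇒≢ {x} xy refl with () ← trans (sym (irrefl H x)) xy

  Walk : ∀ {m} → V → Vec V m → Vec V m → V → Set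
  Walk x []       []       y = Adj H x y
  Walk x (g ∷ gs) (w ∷ ws) y = Adj H x w × Adj H w g × Walk w gs ws y

  walk? : ∀ {m} x (gs ws : Vec V m) y → Dec (Walk x gs ws y)
  walk? x []       []       y = adj? x y
  walk? x (g ∷ gs) (w ∷ ws) y = adj? x w ×-dec adj? w g ×-dec walk? w gs ws y

  walks : ∀ {m} → V → Vec V m → V → ℕ
  walks {m} x gs y = ∑ⱽ m (λ ws → ⟦ walk? x gs ws y ⟧)

  walks-∷ : ∀ {m} x g (gs : Vec V m) y →
            walks x (g ∷ gs) y ≡ ∑[ v < n H ] (A x v * (A v g * walks v gs y))
  walks-∷ {m} x g gs y = sum-cong-≗ through
    where
    open ≡-Reasoning
    through : ∀ v → ∑ⱽ m (λ ws → ⟦ walk? x (g ∷ gs) (v ∷ ws) y ⟧) ≡ A x v * (A v g * walks v gs y)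
    through v = begin
      ∑ⱽ m (λ ws → ⟦ walk? x (g ∷ gs) (v ∷ ws) y ⟧)
        ≡⟨ ∑ⱽ-cong m (λ ws → trans (⟦⟧-×-dec (adj? x v) (adj? v g ×-dec walk? v gs ws y))
                                     (cong (A x v *_) (⟦⟧-×-dec (adj? v g) (walk? v gs ws y)))) ⟩
      ∑ⱽ m (λ ws → A x v * (A v g * ⟦ walk? v gs ws y ⟧))
        ≡⟨ ∑ⱽ-*ˡ m (A x v) _ ⟩
      A x v * ∑ⱽ m (λ ws → A v g * ⟦ walk? v gs ws y ⟧)
        ≡⟨ cong (A x v *_) (∑ⱽ-*ˡ m (A v g) _) ⟩
      A x v * (A v g * walks v gs y) ∎

  deg-sum : ∀ g → deg H g ≡ ∑[ v < n H ] A g v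
  deg-sum g = length-filter-tabulate (adj? g) (λ v → v)

  walks-single-self : ∀ z → walks z (z ∷ []) z ≡ deg H z
  walks-single-self z = trans (walks-∷ z z [] z) (trans (sum-cong-≗ there-and-back) (sym (deg-sum z)))
    where
    there-and-back : ∀ v → A z v * (A v z * A v z) ≡ A z v
    there-and-back v with adj? z v
    ... | no  _  = refl
    ... | yes zv rewrite ⟦⟧-≡1 (adj? v z) (adj-sym zv) = refl

  data NonBacktracking : ∀ {m} → Vec V (2 + m) → Set where
    edge : ∀ {a b} → Adj H a b → NonBacktracking (a ∷ b ∷ [])
    step : ∀ {m a b c} {cs : Vec V m} →
           Adj H a b → a ≢ c → NonBacktracking (b ∷ c ∷ cs) → NonBacktracking (a ∷ b ∷ c ∷ cs)

  nonBacktracking-head : ∀ {m a b} {cs : Vec V m} → NonBacktracking (a ∷ b ∷ cs) → Adj H a b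
  nonBacktracking-head (edge ab)     = ab
  nonBacktracking-head (step ab _ _) = ab

  nonBacktracking-last : ∀ {m} {xs : Vec V (2 + m)} → NonBacktracking xs → Adj H (penultimate xs) (last xs)
  nonBacktracking-last (edge ab)      = ab
  nonBacktracking-last (step _ _ nbt) = nonBacktracking-last nbt

  path-nonBacktracking : ∀ {m} (f : Fin (2 + m) → V) →
    (∀ i j → toℕ j ≡ suc (toℕ i) → Adj H (f i) (f j)) → (∀ i j → f i ≡ f j → i ≡ j) →
    NonBacktracking (tabulate f)
  path-nonBacktracking {zero}  f consecutive injective = edge (consecutive zero (suc zero) refl)
  path-nonBacktracking {suc m} f consecutive injective =
    step (consecutive zero (suc zero) refl) (0≢1+n ∘ injective zero (suc (suc zero)))
         (path-nonBacktracking (f ∘ suc)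
           (λ i j j≡1+i → consecutive (suc i) (suc j) (cong suc j≡1+i))
           (λ i j fi≡fj → Fin-suc-injective (injective (suc i) (suc j) fi≡fj)))

  walk-pinned : ∀ {m x y} {gs ws : Vec V m} → Walk x gs ws y → ∀ i → Adj H (lookup ws i) (lookup gs i)
  walk-pinned {gs = _ ∷ _} {_ ∷ _} (_ , wg , _)    zero    = wg
  walk-pinned {gs = _ ∷ _} {_ ∷ _} (_ , _  , rest) (suc i) = walk-pinned rest i

  walk-steps : ∀ {m x y} {gs ws : Vec V m} → Walk x gs ws y →
               ∀ i j → toℕ j ≡ suc (toℕ i) → Adj H (lookup ws i) (lookup ws j)
  walk-steps {gs = _ ∷ _ ∷ _} {_ ∷ _ ∷ _} (_ , _ , ww′ , _) zero    (suc zero) _     = ww′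
  walk-steps {gs = _ ∷ _}     {_ ∷ _}     (_ , _ , rest)     (suc i) (suc j)    j≡1+i =
    walk-steps rest i j (suc-injective j≡1+i)

  walk-end : ∀ {m x y} {gs ws : Vec V m} → Walk x gs ws y →
             ∀ i → suc (toℕ i) ≡ m → Adj H (lookup ws i) y
  walk-end {gs = _ ∷ []} {_ ∷ []} (_ , _ , wy)   zero    _     = wy
  walk-end {gs = _ ∷ _}  {_ ∷ _}  (_ , _ , rest) (suc i) 1+i≡m = walk-end rest i (suc-injective 1+i≡m)

  walk-intro : ∀ {m x y g w} {gs ws : Vec V m} → Adj H x w →
    (∀ i → Adj H (lookup (w ∷ ws) i) (lookup (g ∷ gs) i)) →
    (∀ i j → toℕ j ≡ suc (toℕ i) → Adj H (lookup (w ∷ ws) i) (lookup (w ∷ ws) j)) →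
    (∀ i → suc (toℕ i) ≡ suc m → Adj H (lookup (w ∷ ws) i) y) →
    Walk x (g ∷ gs) (w ∷ ws) y
  walk-intro {gs = []}    {[]}    xw pinned steps end = xw , pinned zero , end zero refl
  walk-intro {gs = _ ∷ _} {_ ∷ _} xw pinned steps end =
    xw , pinned zero ,
    walk-intro (steps zero (suc zero) refl) (pinned ∘ suc)
               (λ i j j≡1+i → steps (suc i) (suc j) (cong suc j≡1+i))
               (λ i 1+i≡m → end (suc i) (cong suc 1+i≡m))

module SquareFreeWalks (H : Graph) (square-free : SquareFree H) where

  open WalkCounts H

  common-neighbour-unique : ∀ {x y z v} → x ≢ y → Adj H x z → Adj H z y → Adj H x v → Adj H v y → v ≡ z
  common-neighbour-unique {x} {y} {z} {v} x≢y xz zy xv vy with v ≟ z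
  ... | yes v≡z = v≡z
  ... | no  v≢z = ⊥-elim (square-free x z y v (adj⇒≢ xz) x≢y (adj⇒≢ xv) (adj⇒≢ zy) (v≢z ∘ sym)
                            (adj⇒≢ (adj-sym vy)) (xz , zy , adj-sym vy , adj-sym xv))

  walks-forced : ∀ {m x g z} (gs : Vec V m) y → x ≢ g → Adj H x z → Adj H z g →
                 walks x (g ∷ gs) y ≡ walks z gs y
  walks-forced {x = x} {g} {z} gs y x≢g xz zg = begin
    walks x (g ∷ gs) y                             ≡⟨ walks-∷ x g gs y ⟩
    ∑[ v < n H ] (A x v * (A v g * walks v gs y))  ≡⟨ sum-single z off ⟩
    A x z * (A z g * walks z gs y)                 ≡⟨ cong₂ (λ a b → a * (b * walks z gs y))
                                                        (⟦⟧-≡1 (adj? x z) xz) (⟦⟧-≡1 (adj? z g) zg) ⟩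
    1 * (1 * walks z gs y)                         ≡⟨ trans (*-identityˡ _) (*-identityˡ _) ⟩
    walks z gs y                                   ∎
    where
    open ≡-Reasoning
    off : ∀ v → v ≢ z → A x v * (A v g * walks v gs y) ≡ 0
    off v v≢z with adj? x v | adj? v g
    ... | no  _  | _      = refl
    ... | yes _  | no  _  = refl
    ... | yes xv | yes vg = ⊥-elim (v≢z (common-neighbour-unique x≢g xz zg xv vg))

  walks-along : ∀ {m a b} {cs : Vec V m} y → NonBacktracking (a ∷ b ∷ cs) →
                walks a cs y ≡ A (penultimate (a ∷ b ∷ cs)) y
  walks-along y (edge _) = refl
  walks-along y (step {cs = cs} ab a≢c nbt) =
    trans (walks-forced cs y a≢c ab (nonBacktracking-head nbt)) (walks-along y nbt)

  walks-enter : ∀ {m x a g} {gs : Vec V m} y → NonBacktracking (a ∷ g ∷ gs) → Adj H x a → x ≢ g →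
                walks x (g ∷ gs) y ≡ A (penultimate (a ∷ g ∷ gs)) y
  walks-enter {gs = gs} y nbt xa x≢g =
    trans (walks-forced gs y x≢g xa (nonBacktracking-head nbt)) (walks-along y nbt)

  -- Stated with e added on both sides so that no truncated subtraction (deg g ∸ 1) occurs.
  walks-unwind : ∀ {m g r} {rs : Vec V m} y → NonBacktracking (g ∷ r ∷ rs) →
                 let e = A (penultimate (g ∷ r ∷ rs)) y in
                 walks g (g ∷ r ∷ rs) y + e ≡ walks r (r ∷ rs) y + deg H g * e
  walks-unwind {g = g} {r} {rs} y nbt = begin
    walks g (g ∷ r ∷ rs) y + e          ≡⟨ cong (_+ e) (walks-∷ g g (r ∷ rs) y) ⟩
    sum back + e                        ≡⟨ cong (sum back +_) (sym (*-identityˡ e)) ⟩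
    sum back + 1 * e                    ≡⟨ cong (λ a → sum back + a * e) (sym A[g,r]≡1) ⟩
    sum back + A g r * e                ≡⟨ sum-exchange r detour ⟩
    back r + sum (λ v → A g v * e)      ≡⟨ cong₂ _+_ back[r] (sym (*-distribʳ-sum e (A g))) ⟩
    walks r (r ∷ rs) y + sum (A g) * e  ≡⟨ cong (λ d → walks r (r ∷ rs) y + d * e) (sym (deg-sum g)) ⟩
    walks r (r ∷ rs) y + deg H g * e    ∎
    where
    open ≡-Reasoning
    e = A (penultimate (g ∷ r ∷ rs)) y
    gr = nonBacktracking-head nbt
    A[g,r]≡1 : A g r ≡ 1
    A[g,r]≡1 = ⟦⟧-≡1 (adj? g r) gr
    back : V → ℕ
    back v = A g v * (A v g * walks v (r ∷ rs) y)
    back[r] : back r ≡ walks r (r ∷ rs) y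
    back[r] = trans (cong₂ (λ a b → a * (b * walks r (r ∷ rs) y))
                           A[g,r]≡1 (⟦⟧-≡1 (adj? r g) (adj-sym gr)))
                    (trans (*-identityˡ _) (*-identityˡ _))
    detour : ∀ v → v ≢ r → back v ≡ A g v * e
    detour v v≢r with adj? g v
    ... | no  _  = refl
    ... | yes gv = cong (1 *_) (begin
      A v g * walks v (r ∷ rs) y  ≡⟨ cong (_* walks v (r ∷ rs) y) (⟦⟧-≡1 (adj? v g) (adj-sym gv)) ⟩
      1 * walks v (r ∷ rs) y      ≡⟨ *-identityˡ _ ⟩
      walks v (r ∷ rs) y          ≡⟨ walks-forced rs y v≢r (adj-sym gv) gr ⟩
      walks g rs y                ≡⟨ walks-along y nbt ⟩
      e                           ∎)

  walks-telescope : ∀ {p m g r} {rs : Vec V m} y →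
    All (OneModulo p ∘ deg H) (g ∷ r ∷ rs) → NonBacktracking (g ∷ r ∷ rs) →
    let ℓ = last (g ∷ r ∷ rs) in
    OneModulo p (walks ℓ (ℓ ∷ []) y) → OneModulo p (walks g (g ∷ r ∷ rs) y)
  walks-telescope y (dg ∷ _)   nbt@(edge _)       end = oneModulo-cancel end dg (walks-unwind y nbt)
  walks-telescope y (dg ∷ dgs) nbt@(step _ _ nbt′) end =
    oneModulo-cancel (walks-telescope y dgs nbt′ end) dg (walks-unwind y nbt)

  walks-single-apart : ∀ {z y θ} → z ≢ y → Adj H z θ → Adj H θ y → walks z (z ∷ []) y ≡ 1
  walks-single-apart {z} {y} {θ} z≢y zθ θy = begin
    walks z (z ∷ []) y                      ≡⟨ walks-∷ z z [] y ⟩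
    ∑[ v < n H ] (A z v * (A v z * A v y))  ≡⟨ sum-single θ off ⟩
    A z θ * (A θ z * A θ y)                 ≡⟨ cong₂ _*_ (⟦⟧-≡1 (adj? z θ) zθ)
                                                 (cong₂ _*_ (⟦⟧-≡1 (adj? θ z) (adj-sym zθ)) (⟦⟧-≡1 (adj? θ y) θy)) ⟩
    1                                       ∎
    where
    open ≡-Reasoning
    off : ∀ v → v ≢ θ → A z v * (A v z * A v y) ≡ 0
    off v v≢θ with adj? z v | adj? v y
    ... | no  _  | _      = refl
    ... | yes _  | no  _  = cong (_+ 0) (*-zeroʳ (A v z))
    ... | yes zv | yes vy = ⊥-elim (v≢θ (common-neighbour-unique z≢y zθ θy zv vy))

module GadgetHomomorphisms (H : Graph) {k : ℕ} (γ : Fin (suc k) → Fin (n H)) where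

  open WalkCounts H

  K : ℕ
  K = suc k

  vertexMap : V → V → Vec V K → Vec V K → KV K → V
  vertexMap a b ws us vs     = a
  vertexMap a b ws us vt     = b
  vertexMap a b ws us (vv i) = lookup ws i
  vertexMap a b ws us (vu i) = lookup us i

  lookup-decodeK : ∀ a b (ws us : Vec V K) x →
                   lookup (a ∷ b ∷ ws ++ us) x ≡ vertexMap a b ws us (decodeK K x)
  lookup-decodeK a b ws us zero          = refl
  lookup-decodeK a b ws us (suc zero)    = refl
  lookup-decodeK a b ws us (suc (suc x)) rewrite lookup-splitAt K ws us x with splitAt K x
  ... | inj₁ i = refl
  ... | inj₂ i = refl

  encodeK : KV K → Fin (2 + (K + K))
  encodeK vs     = zero
  encodeK vt     = suc zero
  encodeK (vv i) = suc (suc (i ↑ˡ K))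
  encodeK (vu i) = suc (suc (K ↑ʳ i))

  decodeK-encodeK : ∀ z → decodeK K (encodeK z) ≡ z
  decodeK-encodeK vs     = refl
  decodeK-encodeK vt     = refl
  decodeK-encodeK (vv i) rewrite splitAt-↑ˡ K i K = refl
  decodeK-encodeK (vu i) rewrite splitAt-↑ʳ K K i = refl

  lookup-encodeK : ∀ a b (ws us : Vec V K) z → lookup (a ∷ b ∷ ws ++ us) (encodeK z) ≡ vertexMap a b ws us z
  lookup-encodeK a b ws us z =
    trans (lookup-decodeK a b ws us (encodeK z)) (cong (vertexMap a b ws us) (decodeK-encodeK z))

  EdgePreserving : (KV K → V) → Set
  EdgePreserving φ = ∀ z w → T (edgeK K z w) → Adj H (φ z) (φ w)

  edgePreserving⇔walk : ∀ a b (ws us : Vec V K) → EdgePreserving (vertexMap a b ws us) ⇔ Walk a us ws b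
  edgePreserving⇔walk a b (w ∷ ws) (u ∷ us) = mk⇔ to from
    where
    to : EdgePreserving (vertexMap a b (w ∷ ws) (u ∷ us)) → Walk a (u ∷ us) (w ∷ ws) b
    to E = walk-intro (E vs (vv zero) _)
                      (λ i → E (vv i) (vu i) (≡⇒≡ᵇ (toℕ i) (toℕ i) refl))
                      (λ i j j≡1+i → E (vv i) (vv j) (≡⇒≡ᵇ _ _ j≡1+i))
                      (λ i 1+i≡K → E (vv i) vt (≡⇒≡ᵇ _ _ 1+i≡K))
    from : Walk a (u ∷ us) (w ∷ ws) b → EdgePreserving (vertexMap a b (w ∷ ws) (u ∷ us))
    from W vs     (vv zero) _ = proj₁ W
    from W (vv i) (vv j)    e = walk-steps W i j (≡ᵇ⇒≡ _ _ e)
    from W (vv i) (vu j)    e with toℕ-injective (≡ᵇ⇒≡ (toℕ i) (toℕ j) e)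
    ... | refl = walk-pinned W i
    from W (vv i) vt        e = walk-end W i (≡ᵇ⇒≡ _ _ e)

  IsGadgetHom : V → V → Vec V (2 + (K + K)) → Set
  IsGadgetHom y₁ y₂ = IsHom H (𝒦 H K γ) (sK K) (tK K) y₁ y₂

  pinK-encodeK : ∀ i → pinK H K γ (encodeK (vu i)) ≡ just (γ i)
  pinK-encodeK i rewrite decodeK-encodeK (vu i) = refl

  isGadgetHom⇒pinned : ∀ {y₁ y₂ a b} {ws us : Vec V K} → IsGadgetHom y₁ y₂ (a ∷ b ∷ ws ++ us) →
                       us ≡ tabulate γ
  isGadgetHom⇒pinned {a = a} {b} {ws} {us} (_ , pins , _) =
    trans (sym (tabulate∘lookup us)) (tabulate-cong λ i →
      trans (sym (lookup-encodeK a b ws us (vu i)))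
            (subst (λ o → PinOK o (lookup (a ∷ b ∷ ws ++ us) (encodeK (vu i))))
                   (pinK-encodeK i) (pins (encodeK (vu i)))))

  isGadgetHom⇒edgePreserving : ∀ {y₁ y₂ a b} {ws us : Vec V K} → IsGadgetHom y₁ y₂ (a ∷ b ∷ ws ++ us) →
                               EdgePreserving (vertexMap a b ws us)
  isGadgetHom⇒edgePreserving {a = a} {b} {ws} {us} (edges , _) z w zw =
    subst₂ (Adj H) (lookup-encodeK a b ws us z) (lookup-encodeK a b ws us w)
      (edges (encodeK z) (encodeK w) (Equivalence.to T-≡ adjacent))
    where
    adjacent : T (adjK K (encodeK z) (encodeK w))
    adjacent rewrite decodeK-encodeK z | decodeK-encodeK w = Equivalence.from T-∨ (inj₁ zw)

  edgePreserving⇒isGadgetHom : ∀ {y₁ y₂} {ws : Vec V K} → EdgePreserving (vertexMap y₁ y₂ ws (tabulate γ)) →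
                               IsGadgetHom y₁ y₂ (y₁ ∷ y₂ ∷ ws ++ tabulate γ)
  edgePreserving⇒isGadgetHom {y₁} {y₂} {ws} E = edges , pins , refl , refl
    where
    f = y₁ ∷ y₂ ∷ ws ++ tabulate γ
    edges : ∀ x y → adjK K x y ≡ true → Adj H (lookup f x) (lookup f y)
    edges x y xy rewrite lookup-decodeK y₁ y₂ ws (tabulate γ) x | lookup-decodeK y₁ y₂ ws (tabulate γ) y
      with Equivalence.to T-∨ (Equivalence.from T-≡ xy)
    ... | inj₁ e = E (decodeK K x) (decodeK K y) e
    ... | inj₂ e = adj-sym (E (decodeK K y) (decodeK K x) e)
    pins : ∀ x → PinOK (pinK H K γ x) (lookup f x)
    pins x rewrite lookup-decodeK y₁ y₂ ws (tabulate γ) x with decodeK K x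
    ... | vs   = _
    ... | vt   = _
    ... | vv _ = _
    ... | vu i = lookup∘tabulate γ i

  isGadgetHom⇔walk : ∀ y₁ y₂ (ws : Vec V K) →
                     IsGadgetHom y₁ y₂ (y₁ ∷ y₂ ∷ ws ++ tabulate γ) ⇔ Walk y₁ (tabulate γ) ws y₂
  isGadgetHom⇔walk y₁ y₂ ws =
    mk⇔ (Equivalence.to (edgePreserving⇔walk y₁ y₂ ws (tabulate γ)) ∘ isGadgetHom⇒edgePreserving)
        (edgePreserving⇒isGadgetHom ∘ Equivalence.from (edgePreserving⇔walk y₁ y₂ ws (tabulate γ)))

  homCount-𝒦≡walks : ∀ y₁ y₂ → homCount H (𝒦 H K γ) (sK K) (tK K) y₁ y₂ ≡ walks y₁ (tabulate γ) y₂
  homCount-𝒦≡walks y₁ y₂ = begin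
    homCount H (𝒦 H K γ) (sK K) (tK K) y₁ y₂
      ≡⟨ length-filter-allVecs (n H) (2 + (K + K)) hom? ⟩
    ∑[ a < n H ] ∑[ b < n H ] ∑ⱽ (K + K) (λ v → ⟦ hom? (a ∷ b ∷ v) ⟧)
      ≡⟨ sum-single y₁ (λ a a≢y₁ → ∑ⱽ-zero (suc (K + K)) λ v →
           ⟦⟧-≡0 (hom? (a ∷ v)) (a≢y₁ ∘ proj₁ ∘ proj₂ ∘ proj₂)) ⟩
    ∑[ b < n H ] ∑ⱽ (K + K) (λ v → ⟦ hom? (y₁ ∷ b ∷ v) ⟧)
      ≡⟨ sum-single y₂ (λ b b≢y₂ → ∑ⱽ-zero (K + K) λ v →
           ⟦⟧-≡0 (hom? (y₁ ∷ b ∷ v)) (b≢y₂ ∘ proj₂ ∘ proj₂ ∘ proj₂)) ⟩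
    ∑ⱽ (K + K) (λ v → ⟦ hom? (y₁ ∷ y₂ ∷ v) ⟧)
      ≡⟨ ∑ⱽ-++ K K (λ v → ⟦ hom? (y₁ ∷ y₂ ∷ v) ⟧) ⟩
    ∑ⱽ K (λ ws → ∑ⱽ K (λ us → ⟦ hom? (y₁ ∷ y₂ ∷ ws ++ us) ⟧))
      ≡⟨ ∑ⱽ-cong K (λ ws → ∑ⱽ-single (tabulate γ) λ us us≢γ →
           ⟦⟧-≡0 (hom? (y₁ ∷ y₂ ∷ ws ++ us)) (us≢γ ∘ isGadgetHom⇒pinned)) ⟩
    ∑ⱽ K (λ ws → ⟦ hom? (y₁ ∷ y₂ ∷ ws ++ tabulate γ) ⟧)
      ≡⟨ ∑ⱽ-cong K (λ ws → ⟦⟧-⇔ (isGadgetHom⇔walk y₁ y₂ ws)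
           (hom? (y₁ ∷ y₂ ∷ ws ++ tabulate γ)) (walk? y₁ (tabulate γ) ws y₂)) ⟩
    walks y₁ (tabulate γ) y₂ ∎
    where
    open ≡-Reasoning
    hom? : ∀ f → Dec (IsGadgetHom y₁ y₂ f)
    hom? = isHom? H (𝒦 H K γ) (sK K) (tK K) y₁ y₂

lemma8 : (p : ℕ) → Prime p → (H : Graph) → SquareFree H →
    (k' : ℕ) → 1 ≤ k' →
    (θ : Fin (n H)) (γ : Fin (suc k') → Fin (n H)) →
    IsCycle H (suc k') θ γ →
    (∀ i → deg H (γ i) ≡ 1 [mod p ]) →
    ¬ (deg H θ ≡ 1 [mod p ]) →
    (ωs ωt : Fin (n H)) →
    Adj H θ ωs → ωs ≢ γ zero →
    Adj H θ ωt → ωt ≢ γ (fromℕ k') →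
    (homCount H (𝒦 H (suc k') γ) (sK (suc k')) (tK (suc k')) ωs ωt ≡ 0)
    × (homCount H (𝒦 H (suc k') γ) (sK (suc k')) (tK (suc k')) (γ zero) ωt ≡ 1 [mod p ])
    × (homCount H (𝒦 H (suc k') γ) (sK (suc k')) (tK (suc k')) ωs (γ (fromℕ k')) ≡ 1 [mod p ])
    × (homCount H (𝒦 H (suc k') γ) (sK (suc k')) (tK (suc k')) (γ zero) (γ (fromℕ k')) ≡ 1 [mod p ])
lemma8 p p-prime H square-free (suc k) _ θ γ (γ-injective , γ≢θ , γ-path , θγ₀ , γθ) γ-degrees _
       ωs ωt θωs ωs≢γ₀ θωt ωt≢ℓ =
    trans (homCount-𝒦≡walks ωs ωt) (trans (from-ωs ωt) (⟦⟧-≡0 (adj? π ωt) ¬πωt))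
  , oneModulo⇒≡1 (from-γ₀ ωt (0 , walks-single-apart (ωt≢ℓ ∘ sym) ℓθ θωt))
  , oneModulo⇒≡1 (0 , trans (homCount-𝒦≡walks ωs ℓ) (trans (from-ωs ℓ) (⟦⟧-≡1 (adj? π ℓ) πℓ)))
  , oneModulo⇒≡1 (from-γ₀ ℓ (subst (OneModulo p) (sym (walks-single-self ℓ)) (degree-one (fromℕ (suc k)))))
  where
  open WalkCounts H
  open SquareFreeWalks H square-free
  open GadgetHomomorphisms H γ
  ℓ = γ (fromℕ (suc k))
  π = penultimate (tabulate γ)
  degree-one : ∀ i → OneModulo p (deg H (γ i))
  degree-one i = ≡1⇒oneModulo _ p-prime (γ-degrees i)
  nbt : NonBacktracking (tabulate γ)
  nbt = path-nonBacktracking γ γ-path γ-injective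
  ℓθ : Adj H ℓ θ
  ℓθ = γθ (fromℕ (suc k)) (cong suc (toℕ-fromℕ (suc k)))
  πℓ : Adj H π ℓ
  πℓ = subst (Adj H π) (last-tabulate γ) (nonBacktracking-last nbt)
  ¬πωt : ¬ Adj H π ωt
  ¬πωt πωt = penultimate-All (tabulate⁺ {P = _≢ θ} γ≢θ)
                             (common-neighbour-unique (ωt≢ℓ ∘ sym) ℓθ θωt (adj-sym πℓ) πωt)
  from-ωs : ∀ y → walks ωs (tabulate γ) y ≡ A π y
  from-ωs y = walks-enter y (step (θγ₀ zero refl) (γ≢θ (suc zero) ∘ sym) nbt) (adj-sym θωs) ωs≢γ₀
  from-γ₀ : ∀ y → OneModulo p (walks ℓ (ℓ ∷ []) y) →
            OneModulo p (homCount H (𝒦 H K γ) (sK K) (tK K) (γ zero) y)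
  from-γ₀ y end = subst (OneModulo p) (sym (homCount-𝒦≡walks (γ zero) y))
    (walks-telescope y (tabulate⁺ degree-one) nbt
      (subst (λ z → OneModulo p (walks z (z ∷ []) y)) (sym (last-tabulate γ)) end))
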